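{- Let $c\ge1$ be an integer and let ${\bf s}$ be a nonempty square-free string. Then every $c$-BLZ parsing $\varphi$ of ${\bf s}$ has size $|\varphi({\bf s})|\ge \sqrt[c+1]{|{\bf s}|}-1$.
   Context: A string is square-free if it contains no substring of the form ${\bf t}{\bf t}$ with ${\bf t}$ nonempty. For ${\bf s}=s_1\dots s_N$, ${\bf s}[i,j]=s_i\dots s_j$. A parsing of ${\bf s}$ is a partition into consecutive nonempty substrings (phrases); its size $|\varphi({\bf s})|$ is the number of phrases. An LZ-parsing is a parsing in which every phrase ${\bf s}[a,e]$ either has length $1$, or is given together with a chosen source start $b$ with $1\le b\le a-1$ and ${\bf s}[b,b+(e-a)-1]={\bf s}[a,e-1]$ (overlap allowed); each position $a+t$, $0\le t\le e-a-1$, then has source position $b+(t\bmod(a-b))$. The hop-number of position $p$ is $0$ if $p$ is the last position of a phrase and $hop(q)+1$ otherwise, where $q$ is the source position of $p$. A $c$-BLZ parsing is an LZ-parsing in which every hop-number is at most $c$. -}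

module Defs where

open import Data.Nat using (ℕ; zero; suc; _+_; _*_; _∸_; _^_; _≤_; _<_; NonZero)
open import Data.Nat.DivMod using (_%_)
open import Data.List using (List; []; _∷_; length; map)
open import Data.Nat.ListAction using (sum)
open import Data.List.Relation.Unary.All using (All)
open import Data.Maybe using (Maybe; just; nothing)
open import Data.Product using (Σ; ∃; _×_; _,_; proj₁)
open import Relation.Binary.PropositionalEquality using (_≡_)
open import Relation.Nullary using (¬_)

-- 1-indexed character access: s at i = just s_i for 1 ≤ i ≤ |s|, nothing otherwise.
_at_ : {A : Set} → List A → ℕ → Maybe A
[] at _ = nothing
(x ∷ xs) at zero = nothing
(x ∷ xs) at suc zero = just x
(x ∷ xs) at suc (suc i) = xs at suc i

SquareFree : {A : Set} → List A → Set
SquareFree s = ∀ i ℓ → 1 ≤ i → 1 ≤ ℓ → i + 2 * ℓ ∸ 1 ≤ length s →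
  ¬ (∀ t → t < ℓ → s at (i + t) ≡ s at (i + ℓ + t))

-- A phrase: its length, and an optional chosen source start b.
Phrase : Set
Phrase = ℕ × Maybe ℕ

-- A parsing is a list of phrases (in order); phrase k starts right after phrase k-1.
Parsing : Set
Parsing = List Phrase

-- Occ off φ a ℓ mb : phrase with start a, length ℓ, source mb occurs in φ,
-- when the first phrase of φ starts at position off.
data Occ : ℕ → Parsing → ℕ → ℕ → Maybe ℕ → Set where
  here  : ∀ {off ℓ mb φ} → Occ off ((ℓ , mb) ∷ φ) off ℓ mb
  there : ∀ {off l m φ a ℓ mb} → Occ (off + l) φ a ℓ mb → Occ off ((l , m) ∷ φ) a ℓ mb

IsParsing : {A : Set} → List A → Parsing → Set
IsParsing s φ = All (λ ph → 1 ≤ proj₁ ph) φ × sum (map proj₁ φ) ≡ length s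

IsLZ : {A : Set} → List A → Parsing → Set
IsLZ s φ = IsParsing s φ ×
  (∀ a ℓ mb → Occ 1 φ a ℓ mb →
     (mb ≡ nothing → ℓ ≡ 1) ×
     (∀ b → mb ≡ just b →
        1 ≤ b × b < a × (∀ t → t < ℓ ∸ 1 → s at (b + t) ≡ s at (a + t))))

data Hop (φ : Parsing) : ℕ → ℕ → Set where
  last : ∀ {a ℓ mb} → Occ 1 φ a ℓ mb → Hop φ (a + ℓ ∸ 1) 0
  step : ∀ {a ℓ b t h} → Occ 1 φ a ℓ (just b) → t < ℓ ∸ 1 →
         .{{_ : NonZero (a ∸ b)}} →
         Hop φ (b + t % (a ∸ b)) h → Hop φ (a + t) (suc h)

IsBLZ : {A : Set} → ℕ → List A → Parsing → Set
IsBLZ c s φ = IsLZ s φ ×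
  (∀ p → 1 ≤ p → p ≤ length s → ∃ λ h → Hop φ p h × h ≤ c)

{-# OPTIONS --safe #-}
-- Square-freeness forbids a phrase from overlapping its source: a copy at distance d
-- not exceeding the phrase length would produce a square of period d.  Hence every
-- position of a phrase but its last is copied from a position with hop-number exactly
-- one lower, and a run of positions inside a phrase, minus its last position, is
-- copied onto a run of s.  With z phrases, a run with hop-numbers < k+1 splits into at
-- most z pieces, one per phrase, each at most one longer than a run with
-- hop-numbers < k; by induction on k such runs are shorter than (z+1)^k, and all of s
-- is one for k = c+1.
module Submission where

open import Defs
open import Data.Empty using (⊥-elim)
open import Data.List using (List; []; _∷_; length; map)
open import Data.List.Relation.Unary.All using (All; _∷_)
open import Data.Maybe using (Maybe; just; nothing)
open import Data.Nat
  using (ℕ; zero; suc; _+_; _*_; _∸_; _^_; _≤_; _<_; _≤?_; z≤n; s≤s; NonZero; >-nonZero; >-nonZero⁻¹)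
open import Data.Nat.DivMod using (_%_; m<n⇒m%n≡m)
open import Data.Nat.ListAction using (sum)
open import Data.Nat.Properties
open import Data.Product using (∃; ∃₂; _×_; _,_; proj₁; proj₂)
open import Relation.Binary.PropositionalEquality
open import Relation.Nullary using (yes; no)

private variable
  off a a′ ℓ ℓ′ b t t′ x n m k : ℕ
  mb mb′ : Maybe ℕ
  ψ : Parsing
  Q : ℕ → Set

parsedLength : Parsing → ℕ
parsedLength ψ = sum (map proj₁ ψ)

NonemptyPhrases : Parsing → Set
NonemptyPhrases = All (λ ph → 1 ≤ proj₁ ph)

Occ-start≥ : Occ off ψ a ℓ mb → off ≤ a
Occ-start≥ here = ≤-refl
Occ-start≥ (there {off} {l} o) = ≤-trans (m≤m+n off l) (Occ-start≥ o)

Occ-end≤ : Occ off ψ a ℓ mb → a + ℓ ≤ off + parsedLength ψ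
Occ-end≤ {off} {(ℓ , _) ∷ ψ} here = +-monoʳ-≤ off (m≤m+n ℓ (parsedLength ψ))
Occ-end≤ {off} {(l , _) ∷ ψ} (there o) =
  ≤-trans (Occ-end≤ o) (≤-reflexive (+-assoc off l (parsedLength ψ)))

Occ-length≥1 : NonemptyPhrases ψ → Occ off ψ a ℓ mb → 1 ≤ ℓ
Occ-length≥1 (ℓ≥1 ∷ _) here = ℓ≥1
Occ-length≥1 (_ ∷ ℓs≥1) (there o) = Occ-length≥1 ℓs≥1 o

ends-before⇒≢ : a + ℓ ≤ a′ → t < ℓ → a + t ≢ a′ + t′
ends-before⇒≢ {a} {a′ = a′} {t′ = t′} a+ℓ≤a′ t<ℓ eq =
  <-irrefl eq (<-≤-trans (+-monoʳ-< a t<ℓ) (≤-trans a+ℓ≤a′ (m≤m+n a′ t′)))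

Occ-unique : Occ off ψ a ℓ mb → Occ off ψ a′ ℓ′ mb′ →
  a + t ≡ a′ + t′ → t < ℓ → t′ < ℓ′ → a ≡ a′ × ℓ ≡ ℓ′ × mb ≡ mb′
Occ-unique here here _ _ _ = refl , refl , refl
Occ-unique here (there o′) eq t<ℓ _ = ⊥-elim (ends-before⇒≢ (Occ-start≥ o′) t<ℓ eq)
Occ-unique (there o) here eq _ t′<ℓ′ = ⊥-elim (ends-before⇒≢ (Occ-start≥ o) t′<ℓ′ (sym eq))
Occ-unique (there o) (there o′) eq t<ℓ t′<ℓ′ = Occ-unique o o′ eq t<ℓ t′<ℓ′

Run : (ℕ → Set) → ℕ → ℕ → Set
Run Q x m = ∀ j → j < m → Q (x + j)

Run-prefix : Run Q x (n + m) → Run Q x n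
Run-prefix {n = n} {m} run j j<n = run j (≤-trans j<n (m≤m+n n m))

Run-suffix : Run Q x (n + m) → Run Q (x + n) m
Run-suffix {Q = Q} {x} {n} run j j<m =
  subst Q (sym (+-assoc x n j)) (run (n + j) (+-monoʳ-< n j<m))

split-at : ∀ {y} → x ≤ y → y ≤ x + m → ∃₂ λ n m′ → x + n ≡ y × n + m′ ≡ m
split-at x≤y y≤x+m with m≤n⇒∃[o]m+o≡n x≤y
... | n , refl with m≤n⇒∃[o]m+o≡n (+-cancelˡ-≤ _ _ _ y≤x+m)
...   | m′ , n+m′≡m = n , m′ , refl , n+m′≡m

run-covered : ∀ (Q : ℕ → Set) B ψ →
  (∀ {a ℓ mb} → Occ off ψ a ℓ mb → ∀ x n → a ≤ x → x + n ≤ a + ℓ → Run Q x n → n ≤ B) →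
  ∀ x m → off ≤ x → x + m ≤ off + parsedLength ψ → Run Q x m → m ≤ length ψ * B
run-covered {off} _ B [] _ x m off≤x x+m≤off _ = +-cancelˡ-≤ x m 0 (begin
  x + m    ≤⟨ x+m≤off ⟩
  off + 0  ≡⟨ +-identityʳ off ⟩
  off      ≤⟨ off≤x ⟩
  x        ≡⟨ +-identityʳ x ⟨
  x + 0    ∎)
  where open ≤-Reasoning
run-covered {off} Q B ((l , _) ∷ ψ) piece≤B x m off≤x inside run
  with x + m ≤? off + l | off + l ≤? x
... | yes in-first | _ = ≤-trans (piece≤B here x m off≤x in-first run) (m≤m+n B _)
... | no _ | yes past-first =
  ≤-trans (run-covered Q B ψ (λ o → piece≤B (there o)) x m past-first
             (≤-trans inside (≤-reflexive (sym (+-assoc off l _)))) run)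
          (m≤n+m _ B)
... | no leaves-first | no starts-in-first
  with split-at (<⇒≤ (≰⇒> starts-in-first)) (<⇒≤ (≰⇒> leaves-first))
...   | n , m′ , x+n≡end , refl =
  +-mono-≤ (piece≤B here x n off≤x (≤-reflexive x+n≡end) (Run-prefix {Q = Q} {x} run))
           (run-covered Q B ψ (λ o → piece≤B (there o)) (off + l) m′ ≤-refl rest-inside
              (subst (λ y → Run Q y m′) x+n≡end (Run-suffix {Q = Q} {x} run)))
  where
  rest-inside : off + l + m′ ≤ off + l + parsedLength ψ
  rest-inside = begin
    off + l + m′   ≡⟨ cong (_+ m′) x+n≡end ⟨
    x + n + m′     ≡⟨ +-assoc x n m′ ⟩
    x + (n + m′)   ≤⟨ inside ⟩
    off + (l + parsedLength ψ) ≡⟨ +-assoc off l _ ⟨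
    off + l + parsedLength ψ ∎
    where open ≤-Reasoning

HopBelow : Parsing → ℕ → ℕ → Set
HopBelow φ k p = ∃ λ h → Hop φ p h × h < k

Hop-step⁻¹ : ∀ {φ p h} → NonemptyPhrases φ → Occ 1 φ a ℓ (just b) → t < ℓ ∸ 1 →
  .{{_ : NonZero (a ∸ b)}} → Hop φ p h → p ≡ a + t →
  ∃ λ h′ → h ≡ suc h′ × Hop φ (b + t % (a ∸ b)) h′
Hop-step⁻¹ nonempty _ _ (last {ℓ = zero} o′) _ with () ← Occ-length≥1 nonempty o′
Hop-step⁻¹ {a} {ℓ} {t = t} _ o t<ℓ∸1 (last {a′} {suc ℓ′} o′) eq =
  ⊥-elim (not-last (trans (sym eq) (cong (_∸ 1) (+-suc a′ ℓ′))))
  where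
  not-last : a + t ≢ a′ + ℓ′
  not-last a+t≡a′+ℓ′ with Occ-unique o o′ a+t≡a′+ℓ′ (≤-trans t<ℓ∸1 (m∸n≤m ℓ 1)) ≤-refl
  ... | refl , refl , refl = <-irrefl (+-cancelˡ-≡ a t ℓ′ a+t≡a′+ℓ′) t<ℓ∸1
Hop-step⁻¹ {a} {ℓ} {t = t} _ o t<ℓ∸1 (step {t = t′} {h = h′} o′ t′<ℓ′∸1 hop) eq
  with Occ-unique o o′ (sym eq) (≤-trans t<ℓ∸1 (m∸n≤m ℓ 1)) (≤-trans t′<ℓ′∸1 (m∸n≤m _ 1))
... | refl , refl , refl with +-cancelˡ-≡ a t′ t eq
...   | refl = h′ , refl , hop

module _ {A : Set} {s : List A} {φ : Parsing} (square-free : SquareFree s) (lz : IsLZ s φ) where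

  private
    N : ℕ
    N = length s

    nonempty : NonemptyPhrases φ
    nonempty = proj₁ (proj₁ lz)

  phrase-end≤ : Occ 1 φ a ℓ mb → a + ℓ ≤ suc N
  phrase-end≤ o = subst (λ L → _ ≤ suc L) (proj₂ (proj₁ lz)) (Occ-end≤ o)

  unsourced-length : Occ 1 φ a ℓ nothing → ℓ ≡ 1
  unsourced-length o = proj₁ (proj₂ lz _ _ _ o) refl

  source-valid : Occ 1 φ a ℓ (just b) →
    1 ≤ b × b < a × (∀ t → t < ℓ ∸ 1 → s at (b + t) ≡ s at (a + t))
  source-valid o = proj₂ (proj₂ lz _ _ _ o) _ refl

  source-distance≥length : Occ 1 φ a ℓ (just b) → ℓ ≤ a ∸ b
  source-distance≥length {a} {ℓ} {b} o with ℓ ≤? a ∸ b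
  ... | yes ℓ≤d = ℓ≤d
  ... | no ℓ≰d = ⊥-elim (square-free b d 1≤b (m<n⇒0<n∸m b<a) square-fits square)
    where
    d = a ∸ b
    1≤b = proj₁ (source-valid o)
    b<a = proj₁ (proj₂ (source-valid o))
    copies = proj₂ (proj₂ (source-valid o))

    b+d≡a : b + d ≡ a
    b+d≡a = m+[n∸m]≡n (<⇒≤ b<a)

    d<ℓ : d < ℓ
    d<ℓ = ≰⇒> ℓ≰d

    square-fits : b + 2 * d ∸ 1 ≤ N
    square-fits = ≤-pred (begin-strict
      b + 2 * d ∸ 1  ≤⟨ m∸n≤m _ 1 ⟩
      b + 2 * d      ≡⟨ cong (λ e → b + (d + e)) (+-identityʳ d) ⟩
      b + (d + d)    ≡⟨ +-assoc b d d ⟨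
      b + d + d      ≡⟨ cong (_+ d) b+d≡a ⟩
      a + d          <⟨ +-monoʳ-< a d<ℓ ⟩
      a + ℓ          ≤⟨ phrase-end≤ o ⟩
      suc N          ∎)
      where open ≤-Reasoning

    square : ∀ t → t < d → s at (b + t) ≡ s at (b + d + t)
    square t t<d = trans (copies t (<-≤-trans t<d (<⇒≤pred d<ℓ)))
                         (cong (λ p → s at (p + t)) (sym b+d≡a))

  source-distance-nonZero : Occ 1 φ a ℓ (just b) → NonZero (a ∸ b)
  source-distance-nonZero o = >-nonZero (m<n⇒0<n∸m (proj₁ (proj₂ (source-valid o))))

  hop-shift : Occ 1 φ a ℓ (just b) → t < ℓ ∸ 1 →
    HopBelow φ (suc k) (a + t) → HopBelow φ k (b + t)
  hop-shift {a} {ℓ} {b} {t} o t<ℓ∸1 (h , hop , h<1+k)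
    with Hop-step⁻¹ nonempty o t<ℓ∸1 {{source-distance-nonZero o}} hop refl
  ... | h′ , refl , hop′ =
    h′ , subst (λ r → Hop φ (b + r) h′) (m<n⇒m%n≡m {{source-distance-nonZero o}} t<a∸b) hop′
       , ≤-pred h<1+k
    where
    t<a∸b : t < a ∸ b
    t<a∸b = <-≤-trans (≤-trans t<ℓ∸1 (m∸n≤m ℓ 1)) (source-distance≥length o)

  RunsShorterThan : ℕ → ℕ → Set
  RunsShorterThan k B = ∀ x m → 1 ≤ x → x + m ≤ suc N → Run (HopBelow φ k) x m → m < B

  phrase-run≤ : ∀ {B} → 1 ≤ B → RunsShorterThan k B → Occ 1 φ a ℓ mb →
    ∀ x n → a ≤ x → x + n ≤ a + ℓ → Run (HopBelow φ (suc k)) x n → n ≤ B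
  phrase-run≤ {a = a} {ℓ} {nothing} 1≤B _ o x n a≤x x+n≤a+ℓ _ =
    ≤-trans (subst (n ≤_) (unsourced-length o) n≤ℓ) 1≤B
    where
    n≤ℓ : n ≤ ℓ
    n≤ℓ = +-cancelˡ-≤ a n ℓ (≤-trans (+-monoˡ-≤ n a≤x) x+n≤a+ℓ)
  phrase-run≤ {mb = just _} _ _ _ _ zero _ _ _ = z≤n
  phrase-run≤ {k} {a} {ℓ} {just b} _ shorter o x (suc n) a≤x x+n≤a+ℓ run
    with m≤n⇒∃[o]m+o≡n a≤x
  ... | d , refl = shorter (b + d) n (≤-trans 1≤b (m≤m+n b d)) shifted-fits shifted
    where
    1≤b = proj₁ (source-valid o)
    b<a = proj₁ (proj₂ (source-valid o))

    d+n<ℓ : d + n < ℓ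
    d+n<ℓ = +-cancelˡ-≤ a (suc (d + n)) ℓ (begin
      a + suc (d + n)  ≡⟨ cong (a +_) (+-suc d n) ⟨
      a + (d + suc n)  ≡⟨ +-assoc a d (suc n) ⟨
      a + d + suc n    ≤⟨ x+n≤a+ℓ ⟩
      a + ℓ            ∎)
      where open ≤-Reasoning

    shifted-fits : b + d + n ≤ suc N
    shifted-fits = begin
      b + d + n    ≡⟨ +-assoc b d n ⟩
      b + (d + n)  ≤⟨ +-monoʳ-≤ b (<⇒≤ d+n<ℓ) ⟩
      b + ℓ        ≤⟨ +-monoʳ-≤ b (source-distance≥length o) ⟩
      b + (a ∸ b)  ≡⟨ m+[n∸m]≡n (<⇒≤ b<a) ⟩
      a            ≤⟨ m≤m+n a ℓ ⟩
      a + ℓ        ≤⟨ phrase-end≤ o ⟩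
      suc N        ∎
      where open ≤-Reasoning

    shifted : Run (HopBelow φ k) (b + d) n
    shifted j j<n =
      subst (HopBelow φ k) (sym (+-assoc b d j))
        (hop-shift o (<-≤-trans (+-monoʳ-< d j<n) (<⇒≤pred d+n<ℓ))
          (subst (HopBelow φ (suc k)) (+-assoc a d j) (run j (m<n⇒m<1+n j<n))))

  runs-short : ∀ k → RunsShorterThan k ((length φ + 1) ^ k)
  runs-short zero _ zero _ _ _ = s≤s z≤n
  runs-short zero _ (suc _) _ _ run with run 0 (s≤s z≤n)
  ... | _ , _ , ()
  runs-short (suc k) x m 1≤x x+m≤1+N run = begin-strict
    m              ≤⟨ run-covered (HopBelow φ (suc k)) B φ
                        (phrase-run≤ (>-nonZero⁻¹ B) (runs-short k)) x m 1≤x x+m≤1+|φ| run ⟩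
    length φ * B   <⟨ *-monoˡ-< B (m<m+n (length φ) (s≤s z≤n)) ⟩
    (length φ + 1) * B ∎
    where
    open ≤-Reasoning
    B = (length φ + 1) ^ k
    instance
      1+|φ|≢0 : NonZero (length φ + 1)
      1+|φ|≢0 = >-nonZero (m≤n+m 1 (length φ))
      B≢0 : NonZero B
      B≢0 = m^n≢0 (length φ + 1) k
    x+m≤1+|φ| : x + m ≤ 1 + parsedLength φ
    x+m≤1+|φ| = subst (λ L → x + m ≤ suc L) (sym (proj₂ (proj₁ lz))) x+m≤1+N

lemma1 : {A : Set} (c : ℕ) (s : List A) (φ : Parsing) →
    1 ≤ c → 1 ≤ length s → SquareFree s → IsBLZ c s φ →
    length s ≤ (length φ + 1) ^ (c + 1)
lemma1 c s φ _ _ square-free (lz , hops) =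
  <⇒≤ (runs-short {s = s} square-free lz (c + 1) 1 (length s) ≤-refl ≤-refl all-below)
  where
  all-below : Run (HopBelow φ (c + 1)) 1 (length s)
  all-below j j<|s| with hops (suc j) (s≤s z≤n) j<|s|
  ... | h , hop , h≤c = h , hop , subst (h <_) (+-comm 1 c) (s≤s h≤c)
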